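{- Let $M$ be a pseudo-model and $U(M)$ its unravelling. Let $h,h'$ be histories of $M$ and $B\subseteq A$ a non-empty set of agents. If $h\sim^u_a h'$ for all $a\in B$, then $\mathrm{last}(h)\sim_B\mathrm{last}(h')$.
   Context: Fix a finite set $A$ of agents and a set $\mathsf{AP}$ of atomic propositions. A pseudo-model $M=\langle W,\sim,L\rangle$ consists of a set $W$, a symmetric and transitive relation $\sim_B$ on $W$ for each $B\subseteq A$, such that (i) $\sim_{B'}\subseteq\sim_B$ whenever $B\subseteq B'\subseteq A$, and (ii) for all $w\in W$ and $B,B'\subseteq A$, if $w\sim_B w$ and $w\sim_{B'}w$ then $w\sim_{B\cup B'}w$; and $L:W\to\mathcal P(\mathsf{AP})$. A history of $M$ is a finite sequence $h=(w_0,B_1,w_1,\dots,B_k,w_k)$, $k\ge0$, with $w_i\in W$, $B_i\subseteq A$ and $w_{i-1}\sim_{B_i}w_i$ for $1\le i\le k$; $\mathrm{last}(h)=w_k$. Write $h\to_a h'$ if $h'=(h,B_{k+1},w_{k+1})$ with $a\in B_{k+1}$. The unravelling $U(M)=\langle W^u,\sim^u,L^u\rangle$ has as worlds the histories of $M$, $\sim^u_a$ the transitive closure of $\to_a\cup\leftarrow_a$ (where $\leftarrow_a$ is the converse of $\to_a$), and $L^u(h)=L(\mathrm{last}(h))$. -}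

module Defs where

open import Level using (Level; _⊔_; suc)
open import Data.Nat using (ℕ)
open import Data.Fin using (Fin)
open import Data.Fin.Subset using (Subset; _∈_; _⊆_; _∪_; Nonempty)
open import Data.Sum using (_⊎_)
open import Relation.Binary.Core using (Rel)
open import Relation.Binary.Definitions using (Symmetric; Transitive)
open import Relation.Binary.Construct.Closure.Transitive using (TransClosure)

record PseudoModel (n : ℕ) (AP : Set) (w ℓ : Level) : Set (Level.suc (w ⊔ ℓ)) where
  field
    W     : Set w
    _∼[_]_ : W → Subset n → W → Set ℓ
    sym   : ∀ B → Symmetric (λ x y → x ∼[ B ] y)
    trans : ∀ B → Transitive (λ x y → x ∼[ B ] y)
    anti  : ∀ {B B'} → B ⊆ B' → ∀ {x y} → x ∼[ B' ] y → x ∼[ B ] y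
    union : ∀ {B B'} {x} → x ∼[ B ] x → x ∼[ B' ] x → x ∼[ B ∪ B' ] x
    L     : W → AP → Set

module Unravelling {n : ℕ} {AP : Set} {w ℓ : Level} (M : PseudoModel n AP w ℓ) where
  open PseudoModel M

  mutual
    data History : Set (w ⊔ ℓ) where
      start : W → History
      ext   : (h : History) (B : Subset n) (v : W) → last h ∼[ B ] v → History

    last : History → W
    last (start v)     = v
    last (ext _ _ v _) = v

  data _→[_]_ : History → Fin n → History → Set (w ⊔ ℓ) where
    step : ∀ {h B v} (p : last h ∼[ B ] v) {a} → a ∈ B → h →[ a ] ext h B v p

  _∼ᵘ[_]_ : History → Fin n → History → Set (w ⊔ ℓ)
  h ∼ᵘ[ a ] h' = TransClosure (λ x y → (x →[ a ] y) ⊎ (y →[ a ] x)) h h'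

  Lᵘ : History → AP → Set
  Lᵘ h = L (last h)

{-# OPTIONS --safe #-}
-- The histories form a forest, and h ∼ᵘ_a h' forces h and h' to have a
-- common ancestor g from which both are reached by extensions whose coalitions
-- contain a.  Ancestors of one history are linearly ordered, so for different
-- agents the deepest of these common ancestors serves them all at once: every
-- coalition on the two branches below it contains B.  Weakening each step to
-- ∼_B and composing the two branches gives last h ∼_B last h'.  Symmetry and
-- transitivity only relate points already known to be B-reflexive; when both
-- branches are empty this is supplied by axiom (ii), which glues the
-- reflexivities at last h witnessed by the first steps of the a-paths.
module Submission where

open import Defs
open import Level using (Level; _⊔_)
open import Data.Nat using (ℕ; zero; suc; _≤_)
open import Data.Nat.Properties using (≤-refl; ≤-trans; m≤n⇒m≤1+n; 1+n≰n)
open import Data.Fin using (Fin)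
open import Data.Fin.Subset using (Subset; _∈_; _⊆_; _∪_; Nonempty)
open import Data.Fin.Subset.Properties using (_∈?_; p⊆p∪q; q⊆p∪q)
open import Data.Product using (Σ; _×_; _,_; proj₂; swap)
open import Data.Sum using (_⊎_; inj₁; inj₂)
open import Data.Empty using (⊥-elim)
open import Data.List using (List; []; _∷_; filter; allFin)
open import Data.List.Relation.Unary.All as All using (All; []; _∷_)
import Data.List.Membership.Propositional as List
open import Data.List.Membership.Propositional.Properties using (∈-filter⁺; ∈-filter⁻; ∈-allFin)
open import Relation.Binary.Construct.Closure.Transitive using ([_]; _∷_)

members : ∀ {n} → Subset n → List (Fin n)
members {n} B = filter (_∈? B) (allFin n)

∈-members⁺ : ∀ {n} {a : Fin n} {B} → a ∈ B → a List.∈ members B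
∈-members⁺ a∈B = ∈-filter⁺ (_∈? _) (∈-allFin _) a∈B

∈-members⁻ : ∀ {n} {a : Fin n} {B} → a List.∈ members B → a ∈ B
∈-members⁻ a∈L = proj₂ (∈-filter⁻ (_∈? _) {xs = allFin _} a∈L)

module _ {n : ℕ} {AP : Set} {w ℓ : Level} (M : PseudoModel n AP w ℓ) where
  open PseudoModel M
  open Unravelling M

  ∼-reflˡ : ∀ {B x y} → x ∼[ B ] y → x ∼[ B ] x
  ∼-reflˡ x∼y = trans _ x∼y (sym _ x∼y)

  ∼-reflʳ : ∀ {B x y} → x ∼[ B ] y → y ∼[ B ] y
  ∼-reflʳ x∼y = trans _ (sym _ x∼y) x∼y

  ReflexiveCover : List (Fin n) → W → Set ℓ
  ReflexiveCover L x = Σ (Subset n) λ X → All (_∈ X) L × x ∼[ X ] x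

  reflexiveCover-∪ : ∀ {x X₀} → x ∼[ X₀ ] x → (L : List (Fin n)) →
                     All (λ a → ReflexiveCover (a ∷ []) x) L → ReflexiveCover L x
  reflexiveCover-∪ {X₀ = X₀} x∼x [] [] = X₀ , [] , x∼x
  reflexiveCover-∪ x∼x (a ∷ L) ((X , a∈X ∷ [] , x∼ₓx) ∷ covers)
    with reflexiveCover-∪ x∼x L covers
  ... | Y , L⊆Y , x∼ᵧx =
    X ∪ Y , p⊆p∪q Y a∈X ∷ All.map (q⊆p∪q X Y) L⊆Y , union x∼ₓx x∼ᵧx

  depth : History → ℕ
  depth (start _)     = zero
  depth (ext h _ _ _) = suc (depth h)

  data Ancestor (P : Subset n → Set) (g : History) : History → Set (w ⊔ ℓ) where
    here  : Ancestor P g g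
    there : ∀ {h B v} {p : last h ∼[ B ] v} → Ancestor P g h → P B → Ancestor P g (ext h B v p)

  ancestor-depth : ∀ {P g h} → Ancestor P g h → depth g ≤ depth h
  ancestor-depth here        = ≤-refl
  ancestor-depth (there a _) = m≤n⇒m≤1+n (ancestor-depth a)

  ancestor-trans : ∀ {P g k h} → Ancestor P g k → Ancestor P k h → Ancestor P g h
  ancestor-trans a here          = a
  ancestor-trans a (there b pB) = there (ancestor-trans a b) pB

  ancestor-map : ∀ {P Q g h} → (∀ {X} → P X → Q X) → Ancestor P g h → Ancestor Q g h
  ancestor-map f here          = here
  ancestor-map f (there a pB) = there (ancestor-map f a) (f pB)

  ancestor-comparable : ∀ {P Q g₁ g₂ h} → Ancestor P g₁ h → Ancestor Q g₂ h →
                        Ancestor P g₁ g₂ ⊎ Ancestor Q g₂ g₁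
  ancestor-comparable here q = inj₂ q
  ancestor-comparable p here = inj₁ p
  ancestor-comparable (there p _) (there q _) = ancestor-comparable p q

  -- In the absurd clause g₁ = h would lie above g₂, which lies strictly above h.
  ancestor-narrow : ∀ {P Q R g₁ g₂ h} → Ancestor R g₁ g₂ → Ancestor P g₁ h → Ancestor Q g₂ h →
                    Ancestor (λ X → P X × Q X) g₂ h
  ancestor-narrow r p here = here
  ancestor-narrow r here (there q _) =
    ⊥-elim (1+n≰n (≤-trans (ancestor-depth r) (ancestor-depth q)))
  ancestor-narrow r (there p pB) (there q qB) = there (ancestor-narrow r p q) (pB , qB)

  ancestor-reflexive : ∀ {B g h} → Ancestor (B ⊆_) g h →
                       last h ∼[ B ] last h → last g ∼[ B ] last g
  ancestor-reflexive here h∼h = h∼h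
  ancestor-reflexive (there {p = p} a B⊆X) _ = ancestor-reflexive a (∼-reflˡ (anti B⊆X p))

  ancestor-∼ : ∀ {B g h} → Ancestor (B ⊆_) g h → last g ∼[ B ] last g → last g ∼[ B ] last h
  ancestor-∼ here g∼g = g∼g
  ancestor-∼ (there {p = p} a B⊆X) g∼g = trans _ (ancestor-∼ a g∼g) (anti B⊆X p)

  CommonAncestor : (Subset n → Set) → History → History → Set (w ⊔ ℓ)
  CommonAncestor P h h' = Σ History λ g → Ancestor P g h × Ancestor P g h'

  commonAncestor-map : ∀ {P Q h h'} → (∀ {X} → P X → Q X) →
                       CommonAncestor P h h' → CommonAncestor Q h h'
  commonAncestor-map f (g , p , p') = g , ancestor-map f p , ancestor-map f p'

  commonAncestor-× : ∀ {P Q h h'} → CommonAncestor P h h' → CommonAncestor Q h h' →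
                     CommonAncestor (λ X → P X × Q X) h h'
  commonAncestor-× (g₁ , p , p') (g₂ , q , q') with ancestor-comparable p q
  ... | inj₁ g₁≤g₂ = g₂ , ancestor-narrow g₁≤g₂ p q , ancestor-narrow g₁≤g₂ p' q'
  ... | inj₂ g₂≤g₁ = g₁ , ancestor-map swap (ancestor-narrow g₂≤g₁ q p)
                        , ancestor-map swap (ancestor-narrow g₂≤g₁ q' p')

  commonAncestor-All : ∀ {P h h'} → CommonAncestor P h h' → (L : List (Fin n)) →
                       All (λ a → CommonAncestor (a ∈_) h h') L →
                       CommonAncestor (λ X → All (_∈ X) L) h h'
  commonAncestor-All c [] [] = commonAncestor-map (λ _ → []) c
  commonAncestor-All c (a ∷ L) (cₐ ∷ cs) =
    commonAncestor-map (λ (a∈X , L⊆X) → a∈X ∷ L⊆X) (commonAncestor-× cₐ (commonAncestor-All c L cs))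

  Edge : Fin n → History → History → Set (w ⊔ ℓ)
  Edge a x y = (x →[ a ] y) ⊎ (y →[ a ] x)

  edge-reflexiveCover : ∀ {a x y} → Edge a x y → ReflexiveCover (a ∷ []) (last x)
  edge-reflexiveCover (inj₁ (step p a∈B)) = _ , a∈B ∷ [] , ∼-reflˡ p
  edge-reflexiveCover (inj₂ (step p a∈B)) = _ , a∈B ∷ [] , ∼-reflʳ p

  ∼ᵘ-reflexiveCover : ∀ {a h h'} → h ∼ᵘ[ a ] h' → ReflexiveCover (a ∷ []) (last h)
  ∼ᵘ-reflexiveCover [ e ]   = edge-reflexiveCover e
  ∼ᵘ-reflexiveCover (e ∷ _) = edge-reflexiveCover e

  edge-commonAncestor : ∀ {a x y z} → Edge a x y →
                        CommonAncestor (a ∈_) y z → CommonAncestor (a ∈_) x z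
  edge-commonAncestor (inj₁ (step _ a∈B)) (_ , here , r)      = _ , here , ancestor-trans (there here a∈B) r
  edge-commonAncestor (inj₁ (step _ _))   (g , there q _ , r) = g , q , r
  edge-commonAncestor (inj₂ (step _ a∈B)) (g , q , r)         = g , there q a∈B , r

  ∼ᵘ-commonAncestor : ∀ {a h h'} → h ∼ᵘ[ a ] h' → CommonAncestor (a ∈_) h h'
  ∼ᵘ-commonAncestor [ e ]   = edge-commonAncestor e (_ , here , here)
  ∼ᵘ-commonAncestor (e ∷ r) = edge-commonAncestor e (∼ᵘ-commonAncestor r)

  commonAncestor-∼ : ∀ {B h h'} → CommonAncestor (B ⊆_) h h' →
                     last h ∼[ B ] last h → last h ∼[ B ] last h'
  commonAncestor-∼ (g , g≤h , g≤h') h∼h = trans _ (sym _ (ancestor-∼ g≤h g∼g)) (ancestor-∼ g≤h' g∼g)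
    where
    g∼g : last g ∼[ _ ] last g
    g∼g = ancestor-reflexive g≤h h∼h

  module _ {h h' : History} {B : Subset n} {a₀ : Fin n} (a₀∈B : a₀ ∈ B)
           (h∼ᵘh' : ∀ a → a ∈ B → h ∼ᵘ[ a ] h') where

    private
      ⊆-members : ∀ {X} → All (_∈ X) (members B) → B ⊆ X
      ⊆-members L⊆X a∈B = All.lookup L⊆X (∈-members⁺ a∈B)

    ∼ᵘ-reflexive : last h ∼[ B ] last h
    ∼ᵘ-reflexive with reflexiveCover-∪ (proj₂ (proj₂ (∼ᵘ-reflexiveCover (h∼ᵘh' a₀ a₀∈B)))) (members B)
                        (All.tabulate λ a∈L → ∼ᵘ-reflexiveCover (h∼ᵘh' _ (∈-members⁻ a∈L)))
    ... | X , L⊆X , h∼ₓh = anti (⊆-members L⊆X) h∼ₓh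

    ∼ᵘ-commonAncestor-⊇ : CommonAncestor (B ⊆_) h h'
    ∼ᵘ-commonAncestor-⊇ =
      commonAncestor-map ⊆-members
        (commonAncestor-All (∼ᵘ-commonAncestor (h∼ᵘh' a₀ a₀∈B)) (members B)
          (All.tabulate λ a∈L → ∼ᵘ-commonAncestor (h∼ᵘh' _ (∈-members⁻ a∈L))))

lemma39 : {n : ℕ} {AP : Set} {w ℓ : Level} (M : PseudoModel n AP w ℓ)
    (h h' : Unravelling.History M) (B : Subset n) → Nonempty B
    → (∀ a → a ∈ B → Unravelling._∼ᵘ[_]_ M h a h')
    → PseudoModel._∼[_]_ M (Unravelling.last M h) B (Unravelling.last M h')
lemma39 M h h' B (_ , a₀∈B) h∼ᵘh' =
  commonAncestor-∼ M (∼ᵘ-commonAncestor-⊇ M a₀∈B h∼ᵘh') (∼ᵘ-reflexive M a₀∈B h∼ᵘh')
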